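{- Let $\chi_1,\chi_2:\bar\Gamma_0(2)\to\mathbf{C}^\times$ be characters such that $\chi_1(\bar U)$ and $\chi_2(\bar U)$ are both primitive $n$-th roots of unity (for the same $n$) and $\chi_1(\bar V),\chi_2(\bar V)\in\{\pm1\}$ are arbitrary. Then $\ker\chi_1\cap\bar\Gamma(2)=\ker\chi_2\cap\bar\Gamma(2)$; that is, the group $H_0=\ker\chi\cap\bar\Gamma(2)$ depends only on $n$.
   Context: $\Gamma=\mathrm{PSL}_2(\mathbf{Z})$; bars denote images in $\Gamma$ of matrices/subgroups of $\mathrm{SL}_2(\mathbf{Z})$; $T=\begin{pmatrix}1&1\\0&1\end{pmatrix}$, $U=\begin{pmatrix}1&0\\2&1\end{pmatrix}$, $V=TU^{ -1}=\begin{pmatrix}-1&1\\-2&1\end{pmatrix}$; every finite-order character of $\bar\Gamma_0(2)$ is determined by $\chi(\bar U)$ (a root of unity) and $\chi(\bar V)\in\{\pm1\}$. -}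

module Defs where

open import Data.Nat using (ℕ; suc; _<_; NonZero)
open import Data.Integer as ℤ using (ℤ; +_; -[1+_])
open import Data.Integer.Divisibility using (_∣_)
open import Data.Product using (Σ; _×_)
open import Data.Sum using (_⊎_)
open import Relation.Nullary using (¬_)
open import Relation.Binary.PropositionalEquality using (_≡_)
open import Data.Rational.Unnormalised as Q using (ℚᵘ; _≃_)

record Mat : Set where
  constructor mat
  field
    a b c d : ℤ

open Mat public

_·_ : Mat → Mat → Mat
mat a₁ b₁ c₁ d₁ · mat a₂ b₂ c₂ d₂ =
  mat (a₁ ℤ.* a₂ ℤ.+ b₁ ℤ.* c₂) (a₁ ℤ.* b₂ ℤ.+ b₁ ℤ.* d₂)
      (c₁ ℤ.* a₂ ℤ.+ d₁ ℤ.* c₂) (c₁ ℤ.* b₂ ℤ.+ d₁ ℤ.* d₂)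

det : Mat → ℤ
det (mat a b c d) = a ℤ.* d ℤ.- b ℤ.* c

InΓ₀2 : Mat → Set
InΓ₀2 g = (det g ≡ + 1) × (+ 2 ∣ c g)

-- membership in Γ(2) ⊂ SL₂(ℤ): det 1 and g ≡ I (mod 2)
-- (then a, d are automatically odd).  Γ(2) contains -I, so a matrix lies
-- in the preimage of  Γ̄(2)  iff it lies in Γ(2).
InΓ2 : Mat → Set
InΓ2 g = (det g ≡ + 1) × (+ 2 ∣ b g) × (+ 2 ∣ c g)

U V negI : Mat
U = mat (+ 1) (+ 0) (+ 2) (+ 1)
V = mat -[1+ 0 ] (+ 1) -[1+ 1 ] (+ 1)
negI = mat -[1+ 0 ] (+ 0) (+ 0) -[1+ 0 ]

-- The target group: roots of unity in ℂ^×, identified with ℚ/ℤ via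
-- exp(2πi x).  We represent elements of ℚ/ℤ by rationals, compared mod ℤ.
IsInt : ℚᵘ → Set
IsInt x = Σ ℤ λ z → x ≃ (z Q./ 1)

_≡ℤ_ : ℚᵘ → ℚᵘ → Set
x ≡ℤ y = IsInt (x Q.- y)

_·ℚ_ : ℕ → ℚᵘ → ℚᵘ
m ·ℚ x = ((+ m) Q./ 1) Q.* x

half : ℚᵘ
half = (+ 1) Q./ 2

-- A character  χ : Γ̄₀(2) → ℂ^× (with values in roots of unity ≅ ℚ/ℤ),
-- given as a function on matrices that is multiplicative on Γ₀(2) and
-- trivial on -I (so it factors through Γ̄₀(2) = Γ₀(2)/{±I}).
-- Values on matrices outside Γ₀(2) are irrelevant.
record Character : Set where
  field
    χ    : Mat → ℚᵘ
    hom  : ∀ g h → InΓ₀2 g → InΓ₀2 h → χ (g · h) ≡ℤ (χ g Q.+ χ h)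
    negI-triv : IsInt (χ negI)

open Character public

PrimitiveRoot : ℕ → ℚᵘ → Set
PrimitiveRoot n x = (0 < n) × IsInt (n ·ℚ x) × (∀ m → 0 < m → m < n → ¬ IsInt (m ·ℚ x))

IsSign : ℚᵘ → Set
IsSign x = IsInt x ⊎ (x ≡ℤ half)

InKer : Character → Mat → Set
InKer ψ g = IsInt (χ ψ g)

-- Γ̄(2) is generated by T² and U together with -I, which every character kills: Euclid's
-- algorithm on the first column reduces any g ∈ Γ(2) to ±I. Since T = V U and χ(V)² = 1,
-- χ(T²) = χ(U)² for every χ in question, so each g ∈ Γ(2) has an exponent k, depending on g
-- alone, with χ(g) = χ(U)^k. Hence g ∈ ker χ iff χ(U)^k = 1 iff n ∣ k, which involves only n.
module Submission where

open import Defs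
open import Data.Nat as ℕ using (ℕ; zero; suc; z<s)
import Data.Nat.Properties as ℕ
import Data.Nat.Divisibility as ℕ
open import Data.Nat.Induction using (<-wellFounded)
open import Data.Integer as ℤ using (ℤ; +_; -[1+_]; _⊖_)
import Data.Integer.Properties as ℤ
open import Data.Integer.Divisibility.Signed
  using (_∣_; divides; ∣ᵤ⇒∣; ∣⇒∣ᵤ; ∣m⇒∣m*n; ∣n⇒∣m*n; ∣m∣n⇒∣m+n; ∣m∣n⇒∣m-n)
open import Data.Integer.DivMod using (_%ℕ_; _/ℕ_; n%ℕd<d; a≡a%ℕn+[a/ℕn]*n)
open import Data.Integer.Tactic.RingSolver using (solve-∀)
open import Data.Rational.Unnormalised using (ℚᵘ; _≃_; _/_; _+_; _-_; _*_; -_; *≡*; 0ℚᵘ)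
open import Data.Rational.Unnormalised.Properties
  using ( ≃-refl; ≃-reflexive; ≃-sym; ≃-trans; +-cong; -‿cong; *-congˡ; *-congʳ; +-identityˡ; +-identityʳ
        ; +-inverseʳ; *-identityˡ; *-zeroˡ; *-assoc; *-distribʳ-+; neg-distribˡ-* )
open import Data.Rational.Unnormalised.Solver using (module +-*-Solver)
open import Data.Product using (Σ; _×_; _,_; proj₁; proj₂)
open import Data.Sum using (_⊎_; inj₁; inj₂)
open import Function.Bundles using (_⇔_; mk⇔)
import Function.Properties.Equivalence as ⇔
open import Induction.WellFounded using (Acc; acc)
open import Level using (0ℓ)
open import Relation.Binary.Bundles using (Setoid)
open import Relation.Binary.Definitions using (tri<; tri≈; tri>)
open import Relation.Binary.PropositionalEquality using (_≡_; refl; sym; trans; cong; cong₂; subst)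
import Relation.Binary.Reasoning.Setoid
open import Relation.Nullary using (¬_; yes; no; contradiction)

open +-*-Solver using (solve; _:+_; _:-_; :-_; _:=_)

-- Values of characters are read additively in ℚ/ℤ ≅ μ∞, so k ⋆ x is the k-th power of x.
infixr 7 _⋆_
_⋆_ : ℤ → ℚᵘ → ℚᵘ
k ⋆ x = (k / 1) * x

/1-+ : ∀ z w → z / 1 + w / 1 ≃ (z ℤ.+ w) / 1
/1-+ z w = *≡* (lemma z w)
  where
  lemma : ∀ z w → (z ℤ.* + 1 ℤ.+ w ℤ.* + 1) ℤ.* + 1 ≡ (z ℤ.+ w) ℤ.* + 1
  lemma = solve-∀

⋆-distribʳ-+ : ∀ k m u → (k ℤ.+ m) ⋆ u ≃ k ⋆ u + m ⋆ u
⋆-distribʳ-+ k m u = ≃-trans (*-congʳ {u} (≃-sym (/1-+ k m))) (*-distribʳ-+ u (k / 1) (m / 1))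

⋆-assoc : ∀ k m u → (k ℤ.* m) ⋆ u ≃ k ⋆ (m ⋆ u)
⋆-assoc k m u = ≃-trans (*-congʳ {u} /1-*) (*-assoc (k / 1) (m / 1) u)
  where
  /1-* : (k ℤ.* m) / 1 ≃ k / 1 * (m / 1)
  /1-* = *≡* refl

-‿⋆ : ∀ k u → - (k ⋆ u) ≃ (ℤ.- k) ⋆ u
-‿⋆ k u = neg-distribˡ-* (k / 1) u

IsInt-resp-≃ : ∀ {x y} → x ≃ y → IsInt x → IsInt y
IsInt-resp-≃ x≃y (z , x≃z) = z , ≃-trans (≃-sym x≃y) x≃z

IsInt-+ : ∀ {x y} → IsInt x → IsInt y → IsInt (x + y)
IsInt-+ (z , x≃z) (w , y≃w) = z ℤ.+ w , ≃-trans (+-cong x≃z y≃w) (/1-+ z w)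

IsInt-neg : ∀ {x} → IsInt x → IsInt (- x)
IsInt-neg (z , x≃z) = ℤ.- z , -‿cong x≃z

IsInt-⋆ : ∀ k {x} → IsInt x → IsInt (k ⋆ x)
IsInt-⋆ k (z , x≃z) = k ℤ.* z , ≃-trans (*-congˡ {k / 1} x≃z) (*≡* refl)

-- Congruence modulo ℤ, wrapped in a record so that x and y can be inferred from a proof.
infix 4 _≈_
record _≈_ (x y : ℚᵘ) : Set where
  constructor mod-ℤ
  field differ-by-integer : x ≡ℤ y
open _≈_

≈-refl : ∀ {x} → x ≈ x
≈-refl {x} = mod-ℤ (+ 0 , +-inverseʳ x)

≈-sym : ∀ {x y} → x ≈ y → y ≈ x
≈-sym {x} {y} (mod-ℤ p) = mod-ℤ (IsInt-resp-≃ (lemma x y) (IsInt-neg p))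
  where lemma = solve 2 (λ x y → :- (x :- y) := y :- x) ≃-refl

≈-trans : ∀ {x y z} → x ≈ y → y ≈ z → x ≈ z
≈-trans {x} {y} {z} (mod-ℤ p) (mod-ℤ q) = mod-ℤ (IsInt-resp-≃ (lemma x y z) (IsInt-+ p q))
  where lemma = solve 3 (λ x y z → (x :- y) :+ (y :- z) := x :- z) ≃-refl

≈-setoid : Setoid 0ℓ 0ℓ
≈-setoid = record
  { _≈_ = _≈_ ; isEquivalence = record { refl = ≈-refl ; sym = ≈-sym ; trans = ≈-trans } }

module ≈-Reasoning = Relation.Binary.Reasoning.Setoid ≈-setoid

≃⇒≈ : ∀ {x y} → x ≃ y → x ≈ y
≃⇒≈ {x} x≃y = mod-ℤ (IsInt-resp-≃ (+-cong (≃-refl {x}) (-‿cong x≃y)) (differ-by-integer (≈-refl {x})))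

+-cong-≈ : ∀ {x y x' y'} → x ≈ x' → y ≈ y' → x + y ≈ x' + y'
+-cong-≈ {x} {y} {x'} {y'} (mod-ℤ p) (mod-ℤ q) = mod-ℤ (IsInt-resp-≃ (lemma x y x' y') (IsInt-+ p q))
  where lemma = solve 4 (λ x y x' y' → (x :- x') :+ (y :- y') := (x :+ y) :- (x' :+ y')) ≃-refl

-‿cong-≈ : ∀ {x y} → x ≈ y → - x ≈ - y
-‿cong-≈ {x} {y} (mod-ℤ p) = mod-ℤ (IsInt-resp-≃ (lemma x y) (IsInt-neg p))
  where lemma = solve 2 (λ x y → :- (x :- y) := (:- x) :- (:- y)) ≃-refl

IsInt-resp-≈ : ∀ {x y} → x ≈ y → IsInt x → IsInt y
IsInt-resp-≈ {x} {y} (mod-ℤ p) x∈ℤ = IsInt-resp-≃ (lemma x y) (IsInt-+ (IsInt-neg p) x∈ℤ)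
  where lemma = solve 2 (λ x y → (:- (x :- y)) :+ x := y) ≃-refl

IsInt-cong-≈ : ∀ {x y} → x ≈ y → IsInt x ⇔ IsInt y
IsInt-cong-≈ x≈y = mk⇔ (IsInt-resp-≈ x≈y) (IsInt-resp-≈ (≈-sym x≈y))

IsInt⇒≈0 : ∀ {x} → IsInt x → x ≈ 0ℚᵘ
IsInt⇒≈0 {x} x∈ℤ = mod-ℤ (IsInt-resp-≃ (≃-sym (+-identityʳ x)) x∈ℤ)

⋆-integral-∣ : ∀ {n k u} → IsInt (+ n ⋆ u) → + n ∣ k → IsInt (k ⋆ u)
⋆-integral-∣ {n} {u = u} nu∈ℤ (divides q refl) = IsInt-resp-≃ (≃-sym (⋆-assoc q (+ n) u)) (IsInt-⋆ q nu∈ℤ)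

PrimitiveRoot-⋆-integral⇒∣ : ∀ {n u} k → PrimitiveRoot n u → IsInt (k ⋆ u) → + n ∣ k
PrimitiveRoot-⋆-integral⇒∣ {suc n} {u} k (_ , nu∈ℤ , minimal) ku∈ℤ
  with k %ℕ suc n | n%ℕd<d k (suc n) | a≡a%ℕn+[a/ℕn]*n k (suc n)
... | zero  | _   | k≡qn   = divides (k /ℕ suc n) (trans k≡qn (ℤ.+-identityˡ _))
... | suc r | r<n | k≡r+qn = contradiction ru∈ℤ (minimal (suc r) z<s r<n)
  where
  q  = k /ℕ suc n
  qn = q ℤ.* + suc n
  k-qn≃r : k ⋆ u - qn ⋆ u ≃ + suc r ⋆ u
  k-qn≃r = ≃-trans (+-cong k≃r+qn ≃-refl) (lemma (+ suc r ⋆ u) (qn ⋆ u))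
    where
    k≃r+qn = ≃-trans (*-congʳ {u} (≃-reflexive (cong (_/ 1) k≡r+qn))) (⋆-distribʳ-+ (+ suc r) qn u)
    lemma = solve 2 (λ x y → (x :+ y) :- y := x) ≃-refl
  ru∈ℤ : IsInt (+ suc r ⋆ u)
  ru∈ℤ = IsInt-resp-≃ k-qn≃r (IsInt-+ ku∈ℤ (IsInt-neg (⋆-integral-∣ {u = u} nu∈ℤ (divides q refl))))

PrimitiveRoot-⋆-integral⇔∣ : ∀ {n u} k → PrimitiveRoot n u → IsInt (k ⋆ u) ⇔ + n ∣ k
PrimitiveRoot-⋆-integral⇔∣ {u = u} k prim@(_ , nu∈ℤ , _) =
  mk⇔ (PrimitiveRoot-⋆-integral⇒∣ {u = u} k prim) (⋆-integral-∣ {u = u} nu∈ℤ)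

data IsUnit : ℤ → Set where
  one      : IsUnit (+ 1)
  minusOne : IsUnit -[1+ 0 ]

∣z∣≡1⇒IsUnit : ∀ z → ℤ.∣ z ∣ ≡ 1 → IsUnit z
∣z∣≡1⇒IsUnit (+ _)    refl = one
∣z∣≡1⇒IsUnit -[1+ 0 ] _    = minusOne

a*d≡1⇒d≡a : ∀ a d → a ℤ.* d ≡ + 1 → IsUnit a × d ≡ a
a*d≡1⇒d≡a a d ad≡1
  with ∣z∣≡1⇒IsUnit a (ℕ.m*n≡1⇒m≡1 ℤ.∣ a ∣ ℤ.∣ d ∣ ∣ad∣≡1)
     | ∣z∣≡1⇒IsUnit d (ℕ.m*n≡1⇒n≡1 ℤ.∣ a ∣ ℤ.∣ d ∣ ∣ad∣≡1)
  where
  ∣ad∣≡1 : ℤ.∣ a ∣ ℕ.* ℤ.∣ d ∣ ≡ 1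
  ∣ad∣≡1 = trans (sym (ℤ.abs-* a d)) (cong ℤ.∣_∣ ad≡1)
... | one      | one      = one , refl
... | minusOne | minusOne = minusOne , refl
... | one      | minusOne = contradiction ad≡1 λ ()
... | minusOne | one      = contradiction ad≡1 λ ()

IsUnit⇒∣ε∣≡1 : ∀ {ε} → IsUnit ε → ℤ.∣ ε ∣ ≡ 1
IsUnit⇒∣ε∣≡1 one      = refl
IsUnit⇒∣ε∣≡1 minusOne = refl

≢0⇒0<∣z∣ : ∀ {z} → ¬ (z ≡ + 0) → 0 ℕ.< ℤ.∣ z ∣
≢0⇒0<∣z∣ z≢0 = ℕ.n≢0⇒n>0 (λ ∣z∣≡0 → z≢0 (ℤ.∣i∣≡0⇒i≡0 ∣z∣≡0))

∣m⊖n∣<m : ∀ m n → 0 ℕ.< n → n ℕ.< m ℕ.+ m → ℤ.∣ m ⊖ n ∣ ℕ.< m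
∣m⊖n∣<m zero    n 0<n n<0 = contradiction (ℕ.<-trans 0<n n<0) λ ()
∣m⊖n∣<m (suc m) n 0<n n<2m with suc m ℕ.≤? n
... | yes m≤n = subst (ℕ._< suc m) (sym (ℤ.∣⊖∣-≤ m≤n)) (ℕ.m<n+o⇒m∸n<o n (suc m) n<2m)
... | no  m≰n = subst (ℕ._< suc m) (trans (sym (ℤ.∣⊖∣-≤ n≤m)) (ℤ.∣m⊖n∣≡∣n⊖m∣ n (suc m)))
                  (ℕ.∸-monoʳ-< {suc m} {n} {0} 0<n n≤m)
  where n≤m = ℕ.<⇒≤ (ℕ.≰⇒> m≰n)

∣x∓y∣<∣x∣ : ∀ x y → 0 ℕ.< ℤ.∣ y ∣ → ℤ.∣ y ∣ ℕ.< ℤ.∣ x ∣ ℕ.+ ℤ.∣ x ∣ →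
            ℤ.∣ x ℤ.- y ∣ ℕ.< ℤ.∣ x ∣ ⊎ ℤ.∣ x ℤ.+ y ∣ ℕ.< ℤ.∣ x ∣
∣x∓y∣<∣x∣ (+ m)    (+ suc n) 0<n n<2m = inj₁ (∣m⊖n∣<m m (suc n) 0<n n<2m)
∣x∓y∣<∣x∣ (+ m)    -[1+ n ]  0<n n<2m = inj₂ (∣m⊖n∣<m m (suc n) 0<n n<2m)
∣x∓y∣<∣x∣ -[1+ m ] (+ suc n) 0<n n<2m =
  inj₂ (subst (ℕ._< suc m) (ℤ.∣m⊖n∣≡∣n⊖m∣ (suc m) (suc n)) (∣m⊖n∣<m (suc m) (suc n) 0<n n<2m))
∣x∓y∣<∣x∣ -[1+ m ] -[1+ n ]  0<n n<2m =
  inj₁ (subst (ℕ._< suc m) (ℤ.∣m⊖n∣≡∣n⊖m∣ (suc m) (suc n)) (∣m⊖n∣<m (suc m) (suc n) 0<n n<2m))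

∣x+ε2y∣<∣x∣ : ∀ x y → 0 ℕ.< ℤ.∣ y ∣ → ℤ.∣ y ∣ ℕ.< ℤ.∣ x ∣ →
              Σ ℤ λ ε → IsUnit ε × ℤ.∣ x ℤ.+ ε ℤ.* (+ 2 ℤ.* y) ∣ ℕ.< ℤ.∣ x ∣
∣x+ε2y∣<∣x∣ x y 0<∣y∣ ∣y∣<∣x∣ with ∣x∓y∣<∣x∣ x (+ 2 ℤ.* y) 0<∣2y∣ ∣2y∣<2∣x∣
  where
  ∣2y∣≡∣y∣+∣y∣ : ℤ.∣ + 2 ℤ.* y ∣ ≡ ℤ.∣ y ∣ ℕ.+ ℤ.∣ y ∣
  ∣2y∣≡∣y∣+∣y∣ = trans (ℤ.abs-* (+ 2) y) (cong (ℤ.∣ y ∣ ℕ.+_) (ℕ.+-identityʳ ℤ.∣ y ∣))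
  0<∣2y∣ = subst (0 ℕ.<_) (sym ∣2y∣≡∣y∣+∣y∣) (ℕ.<-≤-trans 0<∣y∣ (ℕ.m≤m+n ℤ.∣ y ∣ ℤ.∣ y ∣))
  ∣2y∣<2∣x∣ = subst (ℕ._< _) (sym ∣2y∣≡∣y∣+∣y∣) (ℕ.+-mono-< ∣y∣<∣x∣ ∣y∣<∣x∣)
... | inj₁ ∣x-2y∣<∣x∣ = -[1+ 0 ] , minusOne , subst shrinks-x (sym (ℤ.-1*i≡-i _)) ∣x-2y∣<∣x∣
  where shrinks-x = λ z → ℤ.∣ x ℤ.+ z ∣ ℕ.< ℤ.∣ x ∣
... | inj₂ ∣x+2y∣<∣x∣ = + 1 , one , subst shrinks-x (sym (ℤ.*-identityˡ _)) ∣x+2y∣<∣x∣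
  where shrinks-x = λ z → ℤ.∣ x ℤ.+ z ∣ ℕ.< ℤ.∣ x ∣

I T : Mat
I = mat (+ 1) (+ 0) (+ 0) (+ 1)
T = mat (+ 1) (+ 1) (+ 0) (+ 1)

T²^ U^ : ℤ → Mat
T²^ k = mat (+ 1) (+ 2 ℤ.* k) (+ 0) (+ 1)
U^  k = mat (+ 1) (+ 0) (+ 2 ℤ.* k) (+ 1)

mat-cong : ∀ {a b c d a' b' c' d'} → a ≡ a' → b ≡ b' → c ≡ c' → d ≡ d' → mat a b c d ≡ mat a' b' c' d'
mat-cong refl refl refl refl = refl

T²^·mat : ∀ k a b c d →
          T²^ k · mat a b c d ≡ mat (a ℤ.+ k ℤ.* (+ 2 ℤ.* c)) (b ℤ.+ k ℤ.* (+ 2 ℤ.* d)) c d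
T²^·mat k a b c d = mat-cong (row₁ k a c) (row₁ k b d) (row₂ a c) (row₂ b d)
  where
  row₁ : ∀ k x y → + 1 ℤ.* x ℤ.+ + 2 ℤ.* k ℤ.* y ≡ x ℤ.+ k ℤ.* (+ 2 ℤ.* y)
  row₁ = solve-∀
  row₂ : ∀ x y → + 0 ℤ.* x ℤ.+ + 1 ℤ.* y ≡ y
  row₂ = solve-∀

U^·mat : ∀ k a b c d →
         U^ k · mat a b c d ≡ mat a b (c ℤ.+ k ℤ.* (+ 2 ℤ.* a)) (d ℤ.+ k ℤ.* (+ 2 ℤ.* b))
U^·mat k a b c d = mat-cong (row₁ a c) (row₁ b d) (row₂ k a c) (row₂ k b d)
  where
  row₁ : ∀ x y → + 1 ℤ.* x ℤ.+ + 0 ℤ.* y ≡ x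
  row₁ = solve-∀
  row₂ : ∀ k x y → + 2 ℤ.* k ℤ.* x ℤ.+ + 1 ℤ.* y ≡ y ℤ.+ k ℤ.* (+ 2 ℤ.* x)
  row₂ = solve-∀

det-· : ∀ M N → det (M · N) ≡ det M ℤ.* det N
det-· (mat a b c d) (mat e f g h) = lemma a b c d e f g h
  where
  lemma : ∀ a b c d e f g h →
    (a ℤ.* e ℤ.+ b ℤ.* g) ℤ.* (c ℤ.* f ℤ.+ d ℤ.* h) ℤ.- (a ℤ.* f ℤ.+ b ℤ.* h) ℤ.* (c ℤ.* e ℤ.+ d ℤ.* g)
    ≡ (a ℤ.* d ℤ.- b ℤ.* c) ℤ.* (e ℤ.* h ℤ.- f ℤ.* g)
  lemma = solve-∀

InΓ2-· : ∀ {g h} → InΓ2 g → InΓ2 h → InΓ2 (g · h)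
InΓ2-· {g@(mat a₁ b₁ c₁ d₁)} {h@(mat a₂ b₂ c₂ d₂)} (det₁ , 2∣b₁ , 2∣c₁) (det₂ , 2∣b₂ , 2∣c₂) =
  trans (det-· g h) (cong₂ ℤ._*_ det₁ det₂) ,
  ∣⇒∣ᵤ (∣m∣n⇒∣m+n (∣n⇒∣m*n a₁ (∣ᵤ⇒∣ {+ 2} {b₂} 2∣b₂)) (∣m⇒∣m*n d₂ (∣ᵤ⇒∣ {+ 2} {b₁} 2∣b₁))) ,
  ∣⇒∣ᵤ (∣m∣n⇒∣m+n (∣m⇒∣m*n a₂ (∣ᵤ⇒∣ {+ 2} {c₁} 2∣c₁)) (∣n⇒∣m*n d₁ (∣ᵤ⇒∣ {+ 2} {c₂} 2∣c₂)))

InΓ2⇒InΓ₀2 : ∀ {g} → InΓ2 g → InΓ₀2 g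
InΓ2⇒InΓ₀2 (det≡1 , _ , 2∣c) = det≡1 , 2∣c

InΓ2⇒odd : ∀ {g} → InΓ2 g → ¬ (+ 2 ∣ Mat.a g)
InΓ2⇒odd {mat a b c d} (det≡1 , 2∣b , _) 2∣a =
  ¬2∣1 (subst (+ 2 ∣_) det≡1 (∣m∣n⇒∣m-n (∣m⇒∣m*n d 2∣a) (∣m⇒∣m*n c (∣ᵤ⇒∣ {+ 2} {b} 2∣b))))
  where
  ¬2∣1 : ¬ (+ 2 ∣ + 1)
  ¬2∣1 2∣1 with ℕ.∣1⇒≡1 (∣⇒∣ᵤ 2∣1)
  ... | ()

data Γ2-generator : Mat → Set where
  T²^± : ∀ {ε} → IsUnit ε → Γ2-generator (T²^ ε)
  U^±  : ∀ {ε} → IsUnit ε → Γ2-generator (U^ ε)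

generator-InΓ2 : ∀ {M} → Γ2-generator M → InΓ2 M
generator-InΓ2 (T²^± one)      = refl , ℕ.divides 1 refl , ℕ.divides 0 refl
generator-InΓ2 (T²^± minusOne) = refl , ℕ.divides 1 refl , ℕ.divides 0 refl
generator-InΓ2 (U^± one)       = refl , ℕ.divides 0 refl , ℕ.divides 1 refl
generator-InΓ2 (U^± minusOne)  = refl , ℕ.divides 0 refl , ℕ.divides 1 refl

generator-InΓ₀2 : ∀ {M} → Γ2-generator M → InΓ₀2 M
generator-InΓ₀2 {M} gen = InΓ2⇒InΓ₀2 {M} (generator-InΓ2 gen)

column-size : Mat → ℕ
column-size g = ℤ.∣ Mat.a g ∣ ℕ.+ ℤ.∣ Mat.c g ∣

module _ (P : Mat → Set) (P-I : P I) (P-negI : P negI)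
         (P-pull : ∀ {M g} → Γ2-generator M → InΓ2 g → P (M · g) → P g) where

  private
    upper-det : ∀ a b d → det (mat a b (+ 0) d) ≡ a ℤ.* d
    upper-det = lemma
      where
      lemma : ∀ a b d → a ℤ.* d ℤ.- b ℤ.* + 0 ≡ a ℤ.* d
      lemma = solve-∀

    pull : ∀ {M} g → Γ2-generator M → InΓ2 g → (InΓ2 (M · g) → P (M · g)) → P g
    pull {M} g gen g∈Γ2 P-M·g = P-pull {g = g} gen g∈Γ2 (P-M·g (InΓ2-· {M} {g} (generator-InΓ2 gen) g∈Γ2))

    reduce-upper : ∀ g → InΓ2 g → Mat.c g ≡ + 0 → Acc ℕ._<_ ℤ.∣ Mat.b g ∣ → P g
    reduce-upper g@(mat a b _ d) g∈Γ2@(det≡1 , 2∣b , _) refl (acc rec)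
      with a*d≡1⇒d≡a a d (trans (sym (upper-det a b d)) det≡1) | b ℤ.≟ + 0
    ... | one      , refl | yes refl = P-I
    ... | minusOne , refl | yes refl = P-negI
    ... | u        , refl | no b≢0 =
      pull g (T²^± v) g∈Γ2 λ T²^ε·g∈Γ2 → reduce-upper _ T²^ε·g∈Γ2 (cong Mat.c T²^ε·g≡) (rec ∣b'∣<∣b∣)
      where
      ∣a∣≡1 = IsUnit⇒∣ε∣≡1 u
      ∣a∣<∣b∣ : ℤ.∣ a ∣ ℕ.< ℤ.∣ b ∣
      ∣a∣<∣b∣ = subst (ℕ._< ℤ.∣ b ∣) (sym ∣a∣≡1) (ℕ.∣⇒≤ {{ℕ.>-nonZero (≢0⇒0<∣z∣ b≢0)}} 2∣b)
      descent = ∣x+ε2y∣<∣x∣ b a (subst (0 ℕ.<_) (sym ∣a∣≡1) z<s) ∣a∣<∣b∣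
      ε = proj₁ descent
      v = proj₁ (proj₂ descent)
      T²^ε·g≡ = T²^·mat ε a b (+ 0) a
      ∣b'∣<∣b∣ = subst (λ h → ℤ.∣ Mat.b h ∣ ℕ.< ℤ.∣ b ∣) (sym T²^ε·g≡) (proj₂ (proj₂ descent))

    descend : ∀ g → InΓ2 g → ¬ (Mat.c g ≡ + 0) →
              (∀ {M g'} → Γ2-generator M → M · g ≡ g' → column-size g' ℕ.< column-size g → P g) → P g
    descend g@(mat a b c d) g∈Γ2@(_ , _ , 2∣c) c≢0 shrink with ℕ.<-cmp ℤ.∣ a ∣ ℤ.∣ c ∣
    ... | tri< ∣a∣<∣c∣ _ _ =
      let ε , u , ∣c'∣<∣c∣ = ∣x+ε2y∣<∣x∣ c a 0<∣a∣ ∣a∣<∣c∣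
      in  shrink (U^± u) (U^·mat ε a b c d) (ℕ.+-monoʳ-< ℤ.∣ a ∣ ∣c'∣<∣c∣)
      where 0<∣a∣ = ≢0⇒0<∣z∣ (λ a≡0 → InΓ2⇒odd {g} g∈Γ2 (divides (+ 0) a≡0))
    ... | tri≈ _ ∣a∣≡∣c∣ _ = contradiction (∣ᵤ⇒∣ {+ 2} {a} (subst (2 ℕ.∣_) (sym ∣a∣≡∣c∣) 2∣c)) (InΓ2⇒odd {g} g∈Γ2)
    ... | tri> _ _ ∣c∣<∣a∣ =
      let ε , u , ∣a'∣<∣a∣ = ∣x+ε2y∣<∣x∣ a c (≢0⇒0<∣z∣ c≢0) ∣c∣<∣a∣
      in  shrink (T²^± u) (T²^·mat ε a b c d) (ℕ.+-monoˡ-< ℤ.∣ c ∣ ∣a'∣<∣a∣)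

    reduce : ∀ g → InΓ2 g → Acc ℕ._<_ (column-size g) → P g
    reduce g g∈Γ2 (acc rec) with Mat.c g ℤ.≟ + 0
    ... | yes c≡0 = reduce-upper g g∈Γ2 c≡0 (<-wellFounded _)
    ... | no  c≢0 = descend g g∈Γ2 c≢0 λ gen M·g≡g' shrinks →
      pull g gen g∈Γ2 λ M·g∈Γ2 →
        reduce _ M·g∈Γ2 (rec (subst (ℕ._< column-size g) (sym (cong column-size M·g≡g')) shrinks))

  Γ2-induction : ∀ g → InΓ2 g → P g
  Γ2-induction g g∈Γ2 = reduce g g∈Γ2 (<-wellFounded _)

module _ (ψ : Character) where
  open ≈-Reasoning

  χ-· : ∀ {g h} → InΓ₀2 g → InΓ₀2 h → χ ψ (g · h) ≈ χ ψ g + χ ψ h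
  χ-· g∈Γ₀ h∈Γ₀ = mod-ℤ (hom ψ _ _ g∈Γ₀ h∈Γ₀)

  χ-cancelˡ : ∀ {g h} → InΓ₀2 g → InΓ₀2 h → χ ψ h ≈ χ ψ (g · h) - χ ψ g
  χ-cancelˡ {g} {h} g∈Γ₀ h∈Γ₀ = begin
    χ ψ h                     ≈⟨ ≃⇒≈ (lemma (χ ψ g) (χ ψ h)) ⟩
    (χ ψ g + χ ψ h) - χ ψ g   ≈⟨ +-cong-≈ (χ-· g∈Γ₀ h∈Γ₀) ≈-refl ⟨
    χ ψ (g · h) - χ ψ g       ∎
    where lemma = solve 2 (λ x y → y := (x :+ y) :- x) ≃-refl

  χ-I : χ ψ I ≈ 0ℚᵘ
  χ-I = begin
    χ ψ I               ≈⟨ χ-cancelˡ I∈Γ₀2 I∈Γ₀2 ⟩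
    χ ψ I - χ ψ I       ≈⟨ ≃⇒≈ (+-inverseʳ (χ ψ I)) ⟩
    0ℚᵘ                 ∎
    where I∈Γ₀2 = InΓ2⇒InΓ₀2 {I} (refl , ℕ.divides 0 refl , ℕ.divides 0 refl)

  χ-inverse : ∀ {M M'} → M · M' ≡ I → InΓ₀2 M → InΓ₀2 M' → χ ψ M' ≈ - χ ψ M
  χ-inverse {M} {M'} M·M'≡I M∈Γ₀ M'∈Γ₀ = begin
    χ ψ M'                ≈⟨ χ-cancelˡ M∈Γ₀ M'∈Γ₀ ⟩
    χ ψ (M · M') - χ ψ M  ≡⟨ cong (λ g → χ ψ g - χ ψ M) M·M'≡I ⟩
    χ ψ I - χ ψ M         ≈⟨ +-cong-≈ χ-I ≈-refl ⟩
    0ℚᵘ - χ ψ M           ≈⟨ ≃⇒≈ (+-identityˡ (- χ ψ M)) ⟩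
    - χ ψ M               ∎

TrivialOnV² : Character → Set
TrivialOnV² ψ = IsInt (χ ψ V + χ ψ V)

IsSign⇒TrivialOnV² : ∀ ψ → IsSign (χ ψ V) → TrivialOnV² ψ
IsSign⇒TrivialOnV² ψ (inj₁ v∈ℤ)   = IsInt-+ v∈ℤ v∈ℤ
IsSign⇒TrivialOnV² ψ (inj₂ v≡½) = IsInt-resp-≈ (≈-sym (+-cong-≈ v≈½ v≈½)) (+ 1 , *≡* refl)
  where
  v≈½ : χ ψ V ≈ half
  v≈½ = mod-ℤ v≡½

HasUExponent : Mat → ℤ → Set
HasUExponent g k = ∀ ψ → TrivialOnV² ψ → χ ψ g ≈ k ⋆ χ ψ U

HasUExponent-I : HasUExponent I (+ 0)
HasUExponent-I ψ _ = ≈-trans (χ-I ψ) (≃⇒≈ (≃-sym (*-zeroˡ (χ ψ U))))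

HasUExponent-negI : HasUExponent negI (+ 0)
HasUExponent-negI ψ _ = ≈-trans (IsInt⇒≈0 (negI-triv ψ)) (≃⇒≈ (≃-sym (*-zeroˡ (χ ψ U))))

HasUExponent-U : HasUExponent U (+ 1)
HasUExponent-U ψ _ = ≃⇒≈ (≃-sym (*-identityˡ (χ ψ U)))

HasUExponent-T² : HasUExponent (T²^ (+ 1)) (+ 2)
HasUExponent-T² ψ V²∈ℤ = begin
  χ ψ (T · T)                  ≈⟨ χ-· ψ T∈Γ₀2 T∈Γ₀2 ⟩
  χ ψ (V · U) + χ ψ (V · U)    ≈⟨ +-cong-≈ (χ-· ψ V∈Γ₀2 U∈Γ₀2) (χ-· ψ V∈Γ₀2 U∈Γ₀2) ⟩
  (v + u) + (v + u)            ≈⟨ ≃⇒≈ (lemma v u) ⟩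
  (v + v) + (u + u)            ≈⟨ +-cong-≈ (IsInt⇒≈0 V²∈ℤ) ≈-refl ⟩
  0ℚᵘ + (u + u)                ≈⟨ ≃⇒≈ (+-identityˡ (u + u)) ⟩
  u + u                        ≈⟨ +-cong-≈ (HasUExponent-U ψ V²∈ℤ) (HasUExponent-U ψ V²∈ℤ) ⟩
  + 1 ⋆ u + + 1 ⋆ u            ≈⟨ ≃⇒≈ (⋆-distribʳ-+ (+ 1) (+ 1) u) ⟨
  + 2 ⋆ u                      ∎
  where
  open ≈-Reasoning
  u = χ ψ U
  v = χ ψ V
  T∈Γ₀2 : InΓ₀2 T
  T∈Γ₀2 = refl , ℕ.divides 0 refl
  V∈Γ₀2 : InΓ₀2 V
  V∈Γ₀2 = refl , ℕ.divides 1 refl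
  U∈Γ₀2 : InΓ₀2 U
  U∈Γ₀2 = refl , ℕ.divides 1 refl
  lemma = solve 2 (λ v u → (v :+ u) :+ (v :+ u) := (v :+ v) :+ (u :+ u)) ≃-refl

HasUExponent-inverse : ∀ {M M' k} → M · M' ≡ I → InΓ₀2 M → InΓ₀2 M' →
                       HasUExponent M k → HasUExponent M' (ℤ.- k)
HasUExponent-inverse {M} {M'} {k} M·M'≡I M∈Γ₀ M'∈Γ₀ M^k ψ V²∈ℤ = begin
  χ ψ M'           ≈⟨ χ-inverse ψ M·M'≡I M∈Γ₀ M'∈Γ₀ ⟩
  - χ ψ M          ≈⟨ -‿cong-≈ (M^k ψ V²∈ℤ) ⟩
  - (k ⋆ χ ψ U)    ≈⟨ ≃⇒≈ (-‿⋆ k (χ ψ U)) ⟩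
  (ℤ.- k) ⋆ χ ψ U  ∎
  where open ≈-Reasoning

HasUExponent-cancelˡ : ∀ {M g m k} → InΓ₀2 M → InΓ₀2 g →
                       HasUExponent M m → HasUExponent (M · g) k → HasUExponent g (k ℤ.- m)
HasUExponent-cancelˡ {M} {g} {m} {k} M∈Γ₀ g∈Γ₀ M^m M·g^k ψ V²∈ℤ = begin
  χ ψ g                  ≈⟨ χ-cancelˡ ψ M∈Γ₀ g∈Γ₀ ⟩
  χ ψ (M · g) - χ ψ M    ≈⟨ +-cong-≈ (M·g^k ψ V²∈ℤ) (-‿cong-≈ (M^m ψ V²∈ℤ)) ⟩
  k ⋆ u - m ⋆ u          ≈⟨ ≃⇒≈ (+-cong (≃-refl {k ⋆ u}) (-‿⋆ m u)) ⟩
  k ⋆ u + (ℤ.- m) ⋆ u    ≈⟨ ≃⇒≈ (⋆-distribʳ-+ k (ℤ.- m) u) ⟨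
  (k ℤ.- m) ⋆ u          ∎
  where
  open ≈-Reasoning
  u = χ ψ U

generator-exponent : ∀ {M} → Γ2-generator M → Σ ℤ (HasUExponent M)
generator-exponent (T²^± one)      = + 2 , HasUExponent-T²
generator-exponent (T²^± minusOne) =
  -[1+ 1 ] , HasUExponent-inverse {T²^ (+ 1)} refl
                (generator-InΓ₀2 (T²^± one)) (generator-InΓ₀2 (T²^± minusOne)) HasUExponent-T²
generator-exponent (U^± one)       = + 1 , HasUExponent-U
generator-exponent (U^± minusOne)  =
  -[1+ 0 ] , HasUExponent-inverse {U} refl
                (generator-InΓ₀2 (U^± one)) (generator-InΓ₀2 (U^± minusOne)) HasUExponent-U

Γ2⇒HasUExponent : ∀ g → InΓ2 g → Σ ℤ (HasUExponent g)
Γ2⇒HasUExponent =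
  Γ2-induction (λ g → Σ ℤ (HasUExponent g)) (+ 0 , HasUExponent-I) (+ 0 , HasUExponent-negI) pull
  where
  pull : ∀ {M g} → Γ2-generator M → InΓ2 g → Σ ℤ (HasUExponent (M · g)) → Σ ℤ (HasUExponent g)
  pull {M} {g} gen g∈Γ2 (k , M·g^k) =
    let m , M^m = generator-exponent gen
    in  k ℤ.- m , HasUExponent-cancelˡ {M} {g} (generator-InΓ₀2 gen) (InΓ2⇒InΓ₀2 {g} g∈Γ2) M^m M·g^k

lemma3p1 : (χ₁ χ₂ : Character) (n : ℕ) →
    PrimitiveRoot n (χ χ₁ U) → PrimitiveRoot n (χ χ₂ U) →
    IsSign (χ χ₁ V) → IsSign (χ χ₂ V) →
    ∀ g → InΓ2 g → (InKer χ₁ g ⇔ InKer χ₂ g)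
lemma3p1 χ₁ χ₂ n prim₁ prim₂ sign₁ sign₂ g g∈Γ2 =
  ⇔.trans (ker⇔∣ χ₁ prim₁ sign₁) (⇔.sym (ker⇔∣ χ₂ prim₂ sign₂))
  where
  exponent = Γ2⇒HasUExponent g g∈Γ2
  k = proj₁ exponent
  ker⇔∣ : ∀ ψ → PrimitiveRoot n (χ ψ U) → IsSign (χ ψ V) → InKer ψ g ⇔ + n ∣ k
  ker⇔∣ ψ prim sign = ⇔.trans (IsInt-cong-≈ (proj₂ exponent ψ (IsSign⇒TrivialOnV² ψ sign)))
                              (PrimitiveRoot-⋆-integral⇔∣ {u = χ ψ U} k prim)
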